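{- Fix an integer $\Delta\ge 1$. There exist constants $c_\Delta, C_\Delta>0$ (depending only on $\Delta$) such that for every $n\ge 2$ and every connected graph $G$ on $n$ vertices with maximum degree at most $\Delta$, we have $c_\Delta \log n \le A(G) \le C_\Delta \log n$; that is, $A(G)=\Theta_\Delta(\log n)$.
   Context: For a graph $G$, a vertex $u$ and integer $r\ge 0$, the ball $B(u,r)$ is the set of vertices at graph distance at most $r$ from $u$. $A(G)$ denotes the minimum number of queries of the form "is $v\in B(u,r)$?" (with $u\in V(G)$ and $r\ge 0$ arbitrary) needed in the worst case to determine an unknown vertex $v\in V(G)$ adaptively, i.e. where each query may depend on the answers to previous queries. -}

module Defs where

open import Data.Nat using (ℕ; zero; suc; _≤_; _+_)
open import Data.Fin using (Fin)
open import Data.Bool using (Bool; true; false)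
open import Data.List using (List; map; allFin)
open import Data.Nat.ListAction using (sum)
open import Data.Product using (Σ; _×_; ∃-syntax)
open import Relation.Binary.PropositionalEquality using (_≡_)
open import Relation.Nullary using (¬_)

record Graph (n : ℕ) : Set where
  field
    adj   : Fin n → Fin n → Bool
    sym   : ∀ u v → adj u v ≡ adj v u
    irrefl : ∀ v → adj v v ≡ false
open Graph public

data Walk {n : ℕ} (G : Graph n) : ℕ → Fin n → Fin n → Set where
  here : ∀ {u} → Walk G zero u u
  step : ∀ {k u w v} → adj G u w ≡ true → Walk G k w v → Walk G (suc k) u v

InBall : ∀ {n} → Graph n → Fin n → ℕ → Fin n → Set
InBall G u r v = ∃[ k ] (k ≤ r × Walk G k u v)

Connected : ∀ {n} → Graph n → Set
Connected G = ∀ u v → ∃[ k ] Walk G k u v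

degree : ∀ {n} → Graph n → Fin n → ℕ
degree {n} G v = sum (map (λ w → indicator (adj G v w)) (allFin n))
  where
  indicator : Bool → ℕ
  indicator true  = 1
  indicator false = 0

MaxDegree≤ : ∀ {n} → Graph n → ℕ → Set
MaxDegree≤ G Δ = ∀ v → degree G v ≤ Δ

-- Adaptive query strategies: decision trees whose internal nodes ask
-- "is v ∈ B(u, r)?" and whose leaves output a vertex.
data QTree (n : ℕ) : Set where
  leaf  : Fin n → QTree n
  query : (u : Fin n) (r : ℕ) (yes no : QTree n) → QTree n

depth : ∀ {n} → QTree n → ℕ
depth (leaf _) = 0
depth (query _ _ t s) = suc (depth t Data.Nat.⊔ depth s)
  where import Data.Nat

data Outputs {n : ℕ} (G : Graph n) : QTree n → Fin n → Fin n → Set where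
  out-leaf : ∀ {v w} → Outputs G (leaf w) v w
  out-yes  : ∀ {u r t s v w} → InBall G u r v → Outputs G t v w →
             Outputs G (query u r t s) v w
  out-no   : ∀ {u r t s v w} → ¬ InBall G u r v → Outputs G s v w →
             Outputs G (query u r t s) v w

Determines : ∀ {n} → Graph n → QTree n → Set
Determines G T = ∀ v w → Outputs G T v w → w ≡ v

module Submission where

-- Lower bound: running a query tree of depth d
-- against the unknown vertex can output at most 2^d distinct vertices,
-- so a determining tree has depth ≥ ⌊log₂ n⌋.
--
-- Upper bound, with a = 2Δ+1: every candidate set S of at least two
-- vertices is split by some ball B(u,r) so that both S ∩ B and S ─ B have
-- at most a/(a+1)·|S| elements.  To find it, start with a ball covering the
-- whole (connected) graph and, while the ball holds more than a/(a+1) of S,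
-- move to a neighbour of the centre and shrink the radius by one: since
-- B(u,r+1) ⊆ {u} ∪ ⋃_{w~u} B(w,r) and u has at most Δ neighbours, some
-- neighbour's ball still holds ≥ |S|/(a+1).  Querying such balls
-- recursively gives a tree of depth d for any S with |S|·a^d < 2·(a+1)^d,
-- and Bernoulli's inequality shows that d = a·⌊log₂ n⌋ suffices for S = V.

open import Defs hiding (sym)
open import Data.Nat.Logarithm using (⌊log₂_⌋; ⌊log₂⌋-mono-≤; ⌊log₂[2^n]⌋≡n)
open import Data.Product using (Σ; _×_; _,_; proj₁; proj₂; ∃-syntax)
open import Data.Nat
  using (ℕ; zero; suc; _+_; _*_; _^_; _⊔_; _≤_; _<_; z≤n; s≤s; _≤?_; _<?_; pred; NonZero)
open import Data.Nat.Properties hiding (_≟_)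
open import Data.Nat.Tactic.RingSolver using (solve-∀)
open import Algebra.Properties.CommutativeSemigroup *-commutativeSemigroup
  using (x∙yz≈y∙xz; interchange)
open import Algebra.Properties.Semiring.Sum +-*-semiring
  using (sum; sum-cong-≗; sum-replicate-zero; ∑-distrib-+; ∑-comm; *-distribˡ-sum; *-distribʳ-sum)
open import Data.Fin using (Fin; zero; suc)
open import Data.Fin.Properties using (_≟_; any?)
open import Data.Bool using (Bool; true; false; _∧_; not; if_then_else_)
import Data.Bool.Properties as Bool
open import Data.Sum using (_⊎_; inj₁; inj₂)
open import Data.Empty using (⊥-elim)
import Data.List as L using (map; allFin; tabulate)
import Data.Nat.ListAction as L
open import Data.List.Properties using (map-tabulate; map-cong)
open import Relation.Nullary using (¬_; Dec; yes; no; does)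
open import Relation.Nullary.Decidable using (map′; _⊎-dec_; _×-dec_; dec-true; dec-false)
open import Relation.Binary.PropositionalEquality
  using (_≡_; _≢_; refl; sym; trans; cong; cong₂; subst)

VSet : ℕ → Set
VSet n = Fin n → Bool

_∩_ _─_ : ∀ {n} → VSet n → VSet n → VSet n
(p ∩ q) v = p v ∧ q v
(p ─ q) v = p v ∧ not (q v)

ind : Bool → ℕ
ind true  = 1
ind false = 0

count : ∀ {n} → VSet n → ℕ
count p = sum (λ v → ind (p v))

sum-mono : ∀ {n} {f g : Fin n → ℕ} → (∀ i → f i ≤ g i) → sum f ≤ sum g
sum-mono {zero}  f≤g = z≤n
sum-mono {suc n} f≤g = +-mono-≤ (f≤g zero) (sum-mono (λ i → f≤g (suc i)))

term≤sum : ∀ {n} (f : Fin n → ℕ) i → f i ≤ sum f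
term≤sum f zero    = m≤m+n _ _
term≤sum f (suc i) = ≤-trans (term≤sum (λ j → f (suc j)) i) (m≤n+m _ _)

count-full : ∀ n → count {n} (λ _ → true) ≡ n
count-full zero    = refl
count-full (suc n) = cong suc (count-full n)

count-mono : ∀ {n} {p q : VSet n} → (∀ v → p v ≡ true → q v ≡ true) → count p ≤ count q
count-mono {p = p} p⊆q = sum-mono (λ v → ind-mono (p v) (p⊆q v))
  where
  ind-mono : ∀ b {c} → (b ≡ true → c ≡ true) → ind b ≤ ind c
  ind-mono true  b⇒c rewrite b⇒c refl = ≤-refl
  ind-mono false b⇒c = z≤n

count-split : ∀ {n} (p q : VSet n) → count p ≡ count (p ∩ q) + count (p ─ q)
count-split p q = trans (sum-cong-≗ (λ v → ind-split (p v) (q v)))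
                        (∑-distrib-+ (λ v → ind ((p ∩ q) v)) (λ v → ind ((p ─ q) v)))
  where
  ind-split : ∀ b c → ind b ≡ ind (b ∧ c) + ind (b ∧ not c)
  ind-split true  true  = refl
  ind-split true  false = refl
  ind-split false c     = refl

count-singleton : ∀ {n} (u : Fin n) → count (λ v → does (u ≟ v)) ≡ 1
count-singleton {suc n} zero    = cong suc (sum-replicate-zero n)
count-singleton {suc n} (suc u) = count-singleton u

ind-≤ : ∀ b {x} → (b ≡ true → 1 ≤ x) → ind b ≤ x
ind-≤ true  1≤x = 1≤x refl
ind-≤ false 1≤x = z≤n

∧-true⇒ : ∀ {b c} → (b ∧ c) ≡ true → b ≡ true × c ≡ true
∧-true⇒ {true} {true} _ = refl , refl

∩-intro : ∀ {n} {p q : VSet n} {v} → p v ≡ true → q v ≡ true → (p ∩ q) v ≡ true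
∩-intro pv qv rewrite pv | qv = refl

─-intro : ∀ {n} {p q : VSet n} {v} → p v ≡ true → q v ≡ false → (p ─ q) v ≡ true
─-intro pv qv rewrite pv | qv = refl

does-sound : ∀ {A : Set} (a? : Dec A) → does a? ≡ true → A
does-sound (yes a) _ = a

member⇒count≥1 : ∀ {n} (p : VSet n) {v} → p v ≡ true → 1 ≤ count p
member⇒count≥1 p {v} pv = ≤-trans (≤-reflexive (cong ind (sym pv))) (term≤sum (λ i → ind (p i)) v)

count-two : ∀ {n} (p : VSet n) {v w} → p v ≡ true → p w ≡ true → v ≢ w → 2 ≤ count p
count-two p {zero}  {zero}  pv pw v≢w = ⊥-elim (v≢w refl)
count-two p {zero}  {suc w} pv pw v≢w rewrite pv = s≤s (member⇒count≥1 (λ i → p (suc i)) pw)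
count-two p {suc v} {zero}  pv pw v≢w rewrite pw = s≤s (member⇒count≥1 (λ i → p (suc i)) pv)
count-two p {suc v} {suc w} pv pw v≢w =
  ≤-trans (count-two (λ i → p (suc i)) pv pw (λ v≡w → v≢w (cong suc v≡w))) (m≤n+m _ _)

edgeIf : Bool → Graph 2
edgeIf b = record { adj = edge ; sym = edge-sym ; irrefl = edge-irrefl }
  where
  edge : Fin 2 → Fin 2 → Bool
  edge zero       zero       = false
  edge zero       (suc zero) = b
  edge (suc zero) zero       = b
  edge (suc zero) (suc zero) = false
  edge-sym : ∀ x y → edge x y ≡ edge y x
  edge-sym zero       zero       = refl
  edge-sym zero       (suc zero) = refl
  edge-sym (suc zero) zero       = refl
  edge-sym (suc zero) (suc zero) = refl
  edge-irrefl : ∀ x → edge x x ≡ false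
  edge-irrefl zero       = refl
  edge-irrefl (suc zero) = refl

indicator-unique : (h : Bool → ℕ) → h true ≡ 1 → h false ≡ 0 → ∀ b → h b ≡ ind b
indicator-unique h h-true h-false true  = h-true
indicator-unique h h-true h-false false = h-false

listSum-allFin : ∀ {n} (f : Fin n → ℕ) → L.sum (L.map f (L.allFin n)) ≡ sum f
listSum-allFin {n} f = trans (cong L.sum (map-tabulate (λ i → i) f)) (listSum-tabulate f)
  where
  listSum-tabulate : ∀ {n} (f : Fin n → ℕ) → L.sum (L.tabulate f) ≡ sum f
  listSum-tabulate {zero}  f = refl
  listSum-tabulate {suc n} f = cong (f zero +_) (listSum-tabulate (λ i → f (suc i)))

-- The degree of v is the size of its neighbourhood.  The indicator that
-- `degree` uses locally is recovered as a degree in the graphs edgeIf b.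
degree≡count : ∀ {n} (G : Graph n) v → degree G v ≡ count (adj G v)
degree≡count {n} G v =
  trans (cong L.sum (map-cong (λ w → trans (sym (+-identityʳ _)) (indicator-is-ind (adj G v w))) (L.allFin n)))
        (listSum-allFin (λ w → ind (adj G v w)))
  where
  indicator-is-ind : ∀ b → degree (edgeIf b) zero ≡ ind b
  indicator-is-ind = indicator-unique (λ b → degree (edgeIf b) zero) refl refl

module _ {n} (G : Graph n) where

  neighbourSum : Fin n → (Fin n → ℕ) → ℕ
  neighbourSum u g = sum (λ w → ind (adj G u w) * g w)

  neighbourSum-scale : ∀ k u g → k * neighbourSum u g ≡ neighbourSum u (λ w → k * g w)
  neighbourSum-scale k u g =
    trans (*-distribˡ-sum k (λ w → ind (adj G u w) * g w))
          (sum-cong-≗ (λ w → x∙yz≈y∙xz k (ind (adj G u w)) (g w)))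

  neighbourSum-≤ : ∀ u {g M} → (∀ w → adj G u w ≡ true → g w ≤ M) →
                   neighbourSum u g ≤ degree G u * M
  neighbourSum-≤ u {g} {M} g≤M = begin
    neighbourSum u g               ≤⟨ sum-mono (λ w → term-≤ (adj G u w) (g≤M w)) ⟩
    sum (λ w → ind (adj G u w) * M) ≡⟨ *-distribʳ-sum M (λ w → ind (adj G u w)) ⟨
    count (adj G u) * M            ≡⟨ cong (_* M) (degree≡count G u) ⟨
    degree G u * M                 ∎
    where
    open ≤-Reasoning
    term-≤ : ∀ b {x} → (b ≡ true → x ≤ M) → ind b * x ≤ ind b * M
    term-≤ true  x≤M = *-monoʳ-≤ 1 (x≤M refl)
    term-≤ false x≤M = z≤n

  inBall-zero : ∀ {u v} → InBall G u 0 v → u ≡ v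
  inBall-zero (zero , _ , here) = refl

  Step : ℕ → Fin n → Fin n → Set
  Step r u v = ∃[ w ] (adj G u w ≡ true × InBall G w r v)

  inBall-suc⇒ : ∀ {r u v} → InBall G u (suc r) v → u ≡ v ⊎ Step r u v
  inBall-suc⇒ (zero  , _       , here)       = inj₁ refl
  inBall-suc⇒ (suc k , s≤s k≤r , step uw kv) = inj₂ (_ , uw , k , k≤r , kv)

  ⇒inBall-suc : ∀ {r u v} → u ≡ v ⊎ Step r u v → InBall G u (suc r) v
  ⇒inBall-suc (inj₁ refl)                   = zero , z≤n , here
  ⇒inBall-suc (inj₂ (w , uw , k , k≤r , kv)) = suc k , s≤s k≤r , step uw kv

  inBall? : ∀ r u v → Dec (InBall G u r v)
  inBall? zero    u v = map′ (λ { refl → zero , z≤n , here }) inBall-zero (u ≟ v)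
  inBall? (suc r) u v = map′ ⇒inBall-suc inBall-suc⇒
    ((u ≟ v) ⊎-dec any? (λ w → (adj G u w Bool.≟ true) ×-dec inBall? r w v))

  ball : ℕ → Fin n → VSet n
  ball r u v = does (inBall? r u v)

  -- In a connected graph some ball around u contains every vertex:
  -- take as radius the total length of chosen walks from u.
  covering-radius : Connected G → ∀ u → ∃[ R ] (∀ v → InBall G u R v)
  covering-radius conn u =
    R , λ v → proj₁ (conn u v) , term≤sum (λ x → proj₁ (conn u x)) v , proj₂ (conn u v)
    where
    R : ℕ
    R = sum (λ v → proj₁ (conn u v))

  -- Growth of balls inside a vertex set S:
  -- |S ∩ B(u,r+1)| ≤ 1 + Σ_{w ~ u} |S ∩ B(w,r)|, since B(u,r+1) ⊆ {u} ∪ ⋃_{w ~ u} B(w,r).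
  ball-growth : ∀ S r u → count (S ∩ ball (suc r) u) ≤ 1 + neighbourSum u (λ w → count (S ∩ ball r w))
  ball-growth S r u = begin
    count (S ∩ ball (suc r) u)
      ≤⟨ sum-mono covered ⟩
    sum (λ v → ind (does (u ≟ v)) + sum (λ w → inNeighbourBall w v))
      ≡⟨ ∑-distrib-+ (λ v → ind (does (u ≟ v))) (λ v → sum (λ w → inNeighbourBall w v)) ⟩
    count (λ v → does (u ≟ v)) + sum (λ v → sum (λ w → inNeighbourBall w v))
      ≡⟨ cong₂ _+_ (count-singleton u) (∑-comm (λ v w → inNeighbourBall w v)) ⟩
    1 + sum (λ w → sum (λ v → inNeighbourBall w v))
      ≡⟨ cong (1 +_) (sum-cong-≗ (λ w → *-distribˡ-sum (ind (adj G u w)) (λ v → ind ((S ∩ ball r w) v)))) ⟨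
    1 + neighbourSum u (λ w → count (S ∩ ball r w)) ∎
    where
    open ≤-Reasoning
    inNeighbourBall : Fin n → Fin n → ℕ
    inNeighbourBall w v = ind (adj G u w) * ind ((S ∩ ball r w) v)
    covered : ∀ v → ind ((S ∩ ball (suc r) u) v) ≤ ind (does (u ≟ v)) + sum (λ w → inNeighbourBall w v)
    covered v = ind-≤ ((S ∩ ball (suc r) u) v) λ e →
      let (Sv , uv) = ∧-true⇒ e in cover Sv (inBall-suc⇒ (does-sound (inBall? (suc r) u v) uv))
      where
      cover : S v ≡ true → u ≡ v ⊎ Step r u v → 1 ≤ ind (does (u ≟ v)) + sum (λ w → inNeighbourBall w v)
      cover _  (inj₁ refl)          = ≤-trans (≤-reflexive (cong ind (sym (dec-true (u ≟ u) refl)))) (m≤m+n _ _)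
      cover Sv (inj₂ (w , uw , wv)) =
        ≤-trans witness (≤-trans (term≤sum (λ x → inNeighbourBall x v) w) (m≤n+m _ _))
        where
        witness : 1 ≤ ind (adj G u w) * ind (S v ∧ does (inBall? r w v))
        witness rewrite uw | Sv | dec-true (inBall? r w v) wv = ≤-refl

  run : QTree n → Fin n → Fin n
  run (leaf w)        v = w
  run (query u r t s) v = if ball r u v then run t v else run s v

  run-outputs : ∀ T v → Outputs G T v (run T v)
  run-outputs (leaf w)        v = out-leaf
  run-outputs (query u r t s) v with inBall? r u v
  ... | yes v∈B = out-yes v∈B (run-outputs t v)
  ... | no  v∉B = out-no  v∉B (run-outputs s v)

  identified : QTree n → VSet n
  identified T v = does (run T v ≟ v)

  identified-≤ : ∀ T → count (identified T) ≤ 2 ^ depth T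
  identified-≤ (leaf w) = ≤-reflexive (count-singleton w)
  identified-≤ (query u r t s) = begin
    count (identified (query u r t s))
      ≤⟨ sum-mono branch ⟩
    sum (λ v → ind (identified t v) + ind (identified s v))
      ≡⟨ ∑-distrib-+ (λ v → ind (identified t v)) (λ v → ind (identified s v)) ⟩
    count (identified t) + count (identified s)
      ≤⟨ +-mono-≤ (bound t (m≤m⊔n (depth t) (depth s))) (bound s (m≤n⊔m (depth t) (depth s))) ⟩
    2 ^ d + 2 ^ d
      ≡⟨ cong (2 ^ d +_) (+-identityʳ (2 ^ d)) ⟨
    2 ^ suc d ∎
    where
    open ≤-Reasoning
    d : ℕ
    d = depth t ⊔ depth s
    bound : ∀ T → depth T ≤ d → count (identified T) ≤ 2 ^ d
    bound T dT≤d = ≤-trans (identified-≤ T) (^-monoʳ-≤ 2 dT≤d)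
    branch : ∀ v → ind (identified (query u r t s) v) ≤ ind (identified t v) + ind (identified s v)
    branch v with inBall? r u v
    ... | yes _ = m≤m+n _ _
    ... | no  _ = m≤n+m _ _

  lower-bound : ∀ T → Determines G T → ⌊log₂ n ⌋ ≤ depth T
  lower-bound T determines = begin
    ⌊log₂ n ⌋                ≤⟨ ⌊log₂⌋-mono-≤ all-identified ⟩
    ⌊log₂ (2 ^ depth T) ⌋    ≡⟨ ⌊log₂[2^n]⌋≡n (depth T) ⟩
    depth T                  ∎
    where
    open ≤-Reasoning
    all-identified : n ≤ 2 ^ depth T
    all-identified = ≤-trans (≤-reflexive (sym (count-full n)))
      (≤-trans (count-mono (λ v _ → dec-true (run T v ≟ v) (determines v (run T v) (run-outputs T v))))
               (identified-≤ T))

  Identifies : VSet n → QTree n → Set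
  Identifies S T = ∀ v w → S v ≡ true → Outputs G T v w → w ≡ v

-- B splits S with ratio at worst a : 1: both S ∩ B and S ─ B have
-- at most a/(a+1) of the elements of S.
Balanced : ∀ {n} → ℕ → VSet n → VSet n → Set
Balanced a S B = count S ≤ suc a * count (S ∩ B) × suc a * count (S ∩ B) ≤ a * count S

balanced-outside : ∀ {n} a (S B : VSet n) → Balanced a S B → suc a * count (S ─ B) ≤ a * count S
balanced-outside a S B (S≤K∩ , _) = +-cancelʳ-≤ (count S) _ _ (begin
  suc a * count (S ─ B) + count S                    ≤⟨ +-monoʳ-≤ (suc a * count (S ─ B)) S≤K∩ ⟩
  suc a * count (S ─ B) + suc a * count (S ∩ B)      ≡⟨ *-distribˡ-+ (suc a) (count (S ─ B)) (count (S ∩ B)) ⟨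
  suc a * (count (S ─ B) + count (S ∩ B))            ≡⟨ cong (suc a *_) (+-comm (count (S ─ B)) (count (S ∩ B))) ⟩
  suc a * (count (S ∩ B) + count (S ─ B))            ≡⟨ cong (suc a *_) (count-split S B) ⟨
  suc a * count S                                    ≡⟨ +-comm (count S) (a * count S) ⟩
  a * count S + count S                              ∎)
  where open ≤-Reasoning

potential-step : ∀ a d m c → suc a * c ≤ a * m → m * a ^ suc d < 2 * suc a ^ suc d →
                 c * a ^ d < 2 * suc a ^ d
potential-step a d m c Kc≤am potential = *-cancelˡ-< (suc a) _ _ (begin-strict
  suc a * (c * a ^ d)   ≡⟨ *-assoc (suc a) c (a ^ d) ⟨
  suc a * c * a ^ d     ≤⟨ *-monoˡ-≤ (a ^ d) Kc≤am ⟩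
  a * m * a ^ d         ≡⟨ trans (cong (_* a ^ d) (*-comm a m)) (*-assoc m a (a ^ d)) ⟩
  m * a ^ suc d         <⟨ potential ⟩
  2 * suc a ^ suc d     ≡⟨ x∙yz≈y∙xz 2 (suc a) (suc a ^ d) ⟩
  suc a * (2 * suc a ^ d) ∎)
  where open ≤-Reasoning

module Halving {n} (G : Graph (suc n)) (a : ℕ)
  (balanced-ball : ∀ S → 2 ≤ count S → ∃[ u ] ∃[ r ] Balanced a S (ball G r u)) where

  small-set-tree : ∀ S → count S < 2 → Σ (Fin (suc n)) λ w → Identifies G S (leaf w)
  small-set-tree S small with any? (λ w → S w Bool.≟ true)
  ... | no  empty        = zero , λ v _ Sv _ → ⊥-elim (empty (v , Sv))
  ... | yes (w , Sw)     = w , identifies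
    where
    identifies : Identifies G S (leaf w)
    identifies v .w Sv out-leaf with w ≟ v
    ... | yes w≡v = w≡v
    ... | no  w≢v = ⊥-elim (<-irrefl refl (<-≤-trans small (count-two S Sw Sv w≢v)))

  halving-tree : ∀ d S → count S * a ^ d < 2 * suc a ^ d →
                 ∃[ T ] (depth T ≤ d × Identifies G S T)
  halving-tree d S potential with 2 ≤? count S
  ... | no  small = let (w , identifies) = small-set-tree S (≰⇒> small) in leaf w , z≤n , identifies
  halving-tree zero S potential | yes large = ⊥-elim (<⇒≱ potential (*-monoˡ-≤ 1 large))
  halving-tree (suc d) S potential | yes large with balanced-ball S large
  ... | u , r , balanced@(_ , inside-small)
    with halving-tree d (S ∩ ball G r u) (potential-step a d (count S) _ inside-small potential)
       | halving-tree d (S ─ ball G r u)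
           (potential-step a d (count S) _ (balanced-outside a S (ball G r u) balanced) potential)
  ... | T₁ , depth₁ , identifies₁ | T₂ , depth₂ , identifies₂ =
    query u r T₁ T₂ , s≤s (⊔-lub depth₁ depth₂) , identifies
    where
    identifies : Identifies G S (query u r T₁ T₂)
    identifies v w Sv (out-yes v∈B out) =
      identifies₁ v w (∩-intro {p = S} {q = ball G r u} Sv (dec-true (inBall? G r u v) v∈B)) out
    identifies v w Sv (out-no v∉B out) =
      identifies₂ v w (─-intro {p = S} {q = ball G r u} Sv (dec-false (inBall? G r u v) v∉B)) out

crowding-arith : ∀ Δ m → 2 ≤ m → suc (suc (Δ + Δ)) + Δ * pred m ≤ suc (Δ + Δ) * m
crowding-arith Δ (suc zero)    (s≤s ())
crowding-arith Δ (suc (suc t)) _ = begin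
  suc (suc (Δ + Δ)) + Δ * suc t                            ≤⟨ m≤m+n _ (Δ + Δ * t + t) ⟩
  suc (suc (Δ + Δ)) + Δ * suc t + (Δ + Δ * t + t)          ≡⟨ expand Δ t ⟩
  suc (Δ + Δ) * suc (suc t)                                ∎
  where
  open ≤-Reasoning
  expand : ∀ Δ t → suc (suc (Δ + Δ)) + Δ * suc t + (Δ + Δ * t + t) ≡ suc (Δ + Δ) * suc (suc t)
  expand = solve-∀

module BalancedBall {n} (G : Graph n) (Δ : ℕ) (max-degree : MaxDegree≤ G Δ)
  (S : VSet n) (S-large : 2 ≤ count S) where

  a K m : ℕ
  a = suc (Δ + Δ)
  K = suc a
  m = count S

  inside : ℕ → Fin n → ℕ
  inside r u = count (S ∩ ball G r u)

  Crowded : ℕ → Fin n → Set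
  Crowded r u = a * m < K * inside r u

  -- B(u,0) = {u} holds at most one candidate, and K ≤ a·m.
  not-crowded-zero : ∀ u → ¬ Crowded 0 u
  not-crowded-zero u crowded = <⇒≱ crowded (begin
    K * inside 0 u       ≤⟨ *-monoʳ-≤ K (≤-trans (count-mono centre) (≤-reflexive (count-singleton u))) ⟩
    K * 1                ≡⟨ *-identityʳ K ⟩
    K                    ≤⟨ m≤m+n K (Δ * pred m) ⟩
    K + Δ * pred m       ≤⟨ crowding-arith Δ m S-large ⟩
    a * m                ∎)
    where
    open ≤-Reasoning
    centre : ∀ v → (S ∩ ball G 0 u) v ≡ true → does (u ≟ v) ≡ true
    centre v e = dec-true (u ≟ v) (inBall-zero G (does-sound (inBall? G 0 u v) (proj₂ (∧-true⇒ e))))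

  sparse-neighbours : ∀ r u → (∀ w → adj G u w ≡ true → K * inside r w < m) → ¬ Crowded (suc r) u
  sparse-neighbours r u sparse crowded = <⇒≱ crowded (begin
    K * inside (suc r) u                             ≤⟨ *-monoʳ-≤ K (ball-growth G S r u) ⟩
    K * (1 + neighbourSum G u (inside r))            ≡⟨ *-distribˡ-+ K 1 _ ⟩
    K * 1 + K * neighbourSum G u (inside r)          ≡⟨ cong₂ _+_ (*-identityʳ K) (neighbourSum-scale G K u (inside r)) ⟩
    K + neighbourSum G u (λ w → K * inside r w)      ≤⟨ +-monoʳ-≤ K (neighbourSum-≤ G u (λ w uw → <⇒≤pred (sparse w uw))) ⟩
    K + degree G u * pred m                          ≤⟨ +-monoʳ-≤ K (*-monoˡ-≤ (pred m) (max-degree u)) ⟩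
    K + Δ * pred m                                   ≤⟨ crowding-arith Δ m S-large ⟩
    a * m                                            ∎)
    where open ≤-Reasoning

  -- From a crowded ball, move to a neighbour whose ball of one smaller
  -- radius still holds at least m/K candidates: either that ball is
  -- balanced, or it is crowded and we continue.
  descend : ∀ r u → Crowded r u → ∃[ u' ] ∃[ r' ] Balanced a S (ball G r' u')
  descend zero    u crowded = ⊥-elim (not-crowded-zero u crowded)
  descend (suc r) u crowded with any? (λ w → (adj G u w Bool.≟ true) ×-dec (m ≤? K * inside r w))
  ... | no none = ⊥-elim (sparse-neighbours r u (λ w uw → ≰⇒> (λ big → none (w , uw , big))) crowded)
  ... | yes (w , _ , big) with a * m <? K * inside r w
  ...   | yes crowded-w = descend r w crowded-w
  ...   | no  balanced  = w , r , big , ≮⇒≥ balanced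

  balanced-ball : Connected G → Fin n → ∃[ u ] ∃[ r ] Balanced a S (ball G r u)
  balanced-ball connected u with covering-radius G connected u
  ... | R , covers = descend R u (begin-strict
    a * m             <⟨ +-monoˡ-≤ (a * m) (≤-trans (s≤s z≤n) S-large) ⟩
    m + a * m         ≡⟨ cong (K *_) everything ⟨
    K * inside R u    ∎)
    where
    open ≤-Reasoning
    everything : inside R u ≡ m
    everything = sum-cong-≗ (λ v → cong ind
      (trans (cong (S v ∧_) (dec-true (inBall? G R u v) (covers v))) (Bool.∧-identityʳ (S v))))

-- Bernoulli's inequality in integral form: (1 + 1/a)^c ≥ 1 + c/a.
bernoulli : ∀ a c → a ^ c * (a + c) ≤ a * suc a ^ c
bernoulli a zero    = ≤-reflexive (trans (*-identityˡ (a + 0)) (trans (+-identityʳ a) (sym (*-identityʳ a))))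
bernoulli a (suc c) = begin
  a * a ^ c * (a + suc c)              ≤⟨ m≤m+n _ (a ^ c * c) ⟩
  a * a ^ c * (a + suc c) + a ^ c * c   ≡⟨ expand a (a ^ c) c ⟩
  suc a * (a ^ c * (a + c))            ≤⟨ *-monoʳ-≤ (suc a) (bernoulli a c) ⟩
  suc a * (a * suc a ^ c)              ≡⟨ x∙yz≈y∙xz (suc a) a (suc a ^ c) ⟩
  a * suc a ^ suc c                    ∎
  where
  open ≤-Reasoning
  expand : ∀ a P c → a * P * (a + suc c) + P * c ≡ suc a * (P * (a + c))
  expand = solve-∀

doubling : ∀ a → .{{_ : NonZero a}} → 2 * a ^ a ≤ suc a ^ a
doubling a = *-cancelˡ-≤ a (≤-trans (≤-reflexive (rearrange a (a ^ a))) (bernoulli a a))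
  where
  rearrange : ∀ a P → a * (2 * P) ≡ P * (a + a)
  rearrange = solve-∀

pow-product-≤ : ∀ {x y z} → x * y ≤ z → ∀ L → x ^ L * y ^ L ≤ z ^ L
pow-product-≤ xy≤z zero    = ≤-refl
pow-product-≤ {x} {y} {z} xy≤z (suc L) = begin
  x * x ^ L * (y * y ^ L)      ≡⟨ interchange x (x ^ L) y (y ^ L) ⟩
  x * y * (x ^ L * y ^ L)      ≤⟨ *-mono-≤ xy≤z (pow-product-≤ xy≤z L) ⟩
  z * z ^ L                    ∎
  where open ≤-Reasoning

n<2^suc⌊log₂n⌋ : ∀ n → n < 2 ^ suc ⌊log₂ n ⌋
n<2^suc⌊log₂n⌋ n = ≰⇒> λ 2^≤n → <-irrefl refl (begin-strict
  ⌊log₂ n ⌋                       <⟨ n<1+n ⌊log₂ n ⌋ ⟩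
  suc ⌊log₂ n ⌋                   ≡⟨ ⌊log₂[2^n]⌋≡n (suc ⌊log₂ n ⌋) ⟨
  ⌊log₂ (2 ^ suc ⌊log₂ n ⌋) ⌋     ≤⟨ ⌊log₂⌋-mono-≤ 2^≤n ⟩
  ⌊log₂ n ⌋                       ∎)
  where open ≤-Reasoning

initial-potential : ∀ n a → .{{_ : NonZero a}} →
                    n * a ^ (a * ⌊log₂ n ⌋) < 2 * suc a ^ (a * ⌊log₂ n ⌋)
initial-potential n a = begin-strict
  n * a ^ (a * L)               ≡⟨ cong (n *_) (^-*-assoc a a L) ⟨
  n * X                         <⟨ *-monoˡ-< X (n<2^suc⌊log₂n⌋ n) ⟩
  2 * 2 ^ L * X                 ≡⟨ *-assoc 2 (2 ^ L) X ⟩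
  2 * (2 ^ L * X)               ≤⟨ *-monoʳ-≤ 2 (pow-product-≤ (doubling a) L) ⟩
  2 * (suc a ^ a) ^ L           ≡⟨ cong (2 *_) (^-*-assoc (suc a) a L) ⟩
  2 * suc a ^ (a * L)           ∎
  where
  open ≤-Reasoning
  L X : ℕ
  L = ⌊log₂ n ⌋
  X = (a ^ a) ^ L
  instance
    X≢0 : NonZero X
    X≢0 = m^n≢0 (a ^ a) L {{m^n≢0 a a}}

upper-bound : ∀ {n} Δ (G : Graph (suc n)) → Connected G → MaxDegree≤ G Δ →
              ∃[ T ] (Determines G T × depth T ≤ suc (Δ + Δ) * ⌊log₂ (suc n) ⌋)
upper-bound {n} Δ G connected max-degree =
  let (T , depth≤ , identifies) = halving-tree (a * L) (λ _ → true) potential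
  in T , (λ v w → identifies v w refl) , depth≤
  where
  a L : ℕ
  a = suc (Δ + Δ)
  L = ⌊log₂ (suc n) ⌋
  open Halving G a (λ S large → BalancedBall.balanced-ball G Δ max-degree S large connected zero)
  potential : count {suc n} (λ _ → true) * a ^ (a * L) < 2 * suc a ^ (a * L)
  potential = subst (λ k → k * a ^ (a * L) < 2 * suc a ^ (a * L))
                    (sym (count-full (suc n))) (initial-potential (suc n) a)

theorem1p2 : (Δ : ℕ) → 1 ≤ Δ →
    ∃[ a ] ∃[ C ] (1 ≤ a × 1 ≤ C ×
      ((n : ℕ) → 2 ≤ n → (G : Graph n) → Connected G → MaxDegree≤ G Δ →
        ((T : QTree n) → Determines G T → ⌊log₂ n ⌋ ≤ a * depth T)
        × (∃[ T ] (Determines G T × depth T ≤ C * ⌊log₂ n ⌋))))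
theorem1p2 Δ _ = 1 , suc (Δ + Δ) , s≤s z≤n , s≤s z≤n , bounds
  where
  bounds : (n : ℕ) → 2 ≤ n → (G : Graph n) → Connected G → MaxDegree≤ G Δ →
           ((T : QTree n) → Determines G T → ⌊log₂ n ⌋ ≤ 1 * depth T)
           × (∃[ T ] (Determines G T × depth T ≤ suc (Δ + Δ) * ⌊log₂ n ⌋))
  bounds (suc n) _ G connected max-degree =
    (λ T determines → ≤-trans (lower-bound G T determines) (≤-reflexive (sym (*-identityˡ (depth T))))) ,
    upper-bound Δ G connected max-degree
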